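{- Let $c_1,c_2,\ldots$ be an infinite sequence of complete histories, none of which has a $\mathsf{VFresh}$, $\mathsf{VRepet}$, $\mathsf{VOrd}$ or $\mathsf{VWit}$ violation, such that for every $i$, $c_i$ is a prefix of $c_{i+1}$ and the number of dequeue events in $c_i$ is less than that in $c_{i+1}$. If $c_1$ contains an enqueue event $\mathtt{enq}(x)$, then some $c_j$ contains a dequeue event $\mathtt{deq}(x)$ returning $x$.
   Context: A queue event is a tuple $(u,m,d_{in},d_{out})$ with unique identifier $u$, $m\in\{\mathtt{enq},\mathtt{deq}\}$; $\mathtt{enq}(x)$ denotes an enqueue of $x\in\mathbb{N}$ and $\mathtt{deq}(x)$ a dequeue returning $x\in\mathbb{N}\cup\{\mathtt{NULL}\}$. Each event $a$ has invocation $\mathit{inv}(a)$ and response $\mathit{res}(a)$; a history is a finite sequence of such actions, each at most once, responses after invocations; complete if every invoked event responded. $e\prec_c e'$ iff $\mathit{res}(e)$ occurs before $\mathit{inv}(e')$ in $c$. $\mathrm{Enq}(c)$, $\mathrm{Deq}(c)$ are the enqueue/dequeue events, $\mathrm{Val}(c,e)$ the value enqueued or returned. Each value is assumed enqueued at most once. Violations of complete $c$: ($\mathsf{VFresh}$) some $x\neq\mathtt{NULL}$ has $\mathtt{deq}(x)\in\mathrm{Deq}(c)$ and either $\mathtt{enq}(x)\notin\mathrm{Enq}(c)$ or $\mathtt{deq}(x)\prec_c\mathtt{enq}(x)$; ($\mathsf{VRepet}$) there are distinct $d,d'\in\mathrm{Deq}(c)$ with $\mathrm{Val}(c,d)=\mathrm{Val}(c,d')\neq\mathtt{NULL}$;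 ($\mathsf{VOrd}$) there are values $x,y$ with $\mathtt{enq}(y)\prec_c\mathtt{enq}(x)$, $\mathtt{deq}(x)\in\mathrm{Deq}(c)$, and either no dequeue of $y$ is in $\mathrm{Deq}(c)$ or $\mathtt{deq}(x)\prec_c\mathtt{deq}(y)$; ($\mathsf{VWit}$) there is a dequeue event $d$ returning $\mathtt{NULL}$, writing $c=c_0\cdot\mathit{inv}(d)\cdot c_d\cdot\mathit{res}(d)\cdot c_3$, such that for every split $c_d=c_1\cdot c_2$ there exists an enqueue event $\mathtt{enq}(x)$ completed in $c_0\cdot\mathit{inv}(d)\cdot c_1$ such that the invocation of a dequeue returning $x$ does not occur in $c_0\cdot\mathit{inv}(d)\cdot c_1$. -}

module Defs where

open import Data.Nat using (ℕ; _<_)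
open import Data.Maybe using (Maybe; just; nothing)
open import Data.List using (List; []; _∷_; _++_)
open import Data.List.Membership.Propositional using (_∈_)
open import Data.List.Relation.Unary.Unique.Propositional using (Unique)
open import Data.Product using (Σ; ∃; ∃-syntax; _×_; _,_)
open import Data.Sum using (_⊎_)
open import Relation.Binary.PropositionalEquality using (_≡_)
open import Relation.Nullary using (¬_)

-- Values returned by dequeues: just x is the value x, nothing is NULL.
data Op : Set where
  enq : ℕ → Op
  deq : Maybe ℕ → Op

-- A queue event (u, m, d_in, d_out): identifier plus method/argument/result.
record Event : Set where
  constructor event
  field
    uid : ℕ
    op  : Op
open Event public

data Action : Set where
  inv : Event → Action
  res : Event → Action

History : Set
History = List Action

Before : History → Action → Action → Set
Before c a b = ∃[ c₁ ] ∃[ c₂ ] ∃[ c₃ ] (c ≡ c₁ ++ (a ∷ c₂ ++ (b ∷ c₃)))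

_∈ev_ : Event → History → Set
e ∈ev c = inv e ∈ c

record WellFormed (c : History) : Set where
  field
    unique-actions : Unique c
    res-after-inv  : ∀ e → res e ∈ c → Before c (inv e) (res e)
    unique-ids     : ∀ e e' → e ∈ev c → e' ∈ev c → uid e ≡ uid e' → e ≡ e'
    enq-once       : ∀ e e' x → e ∈ev c → e' ∈ev c →
                     op e ≡ enq x → op e' ≡ enq x → e ≡ e'

Complete : History → Set
Complete c = ∀ e → inv e ∈ c → res e ∈ c

record CompleteHistory (c : History) : Set where
  field
    wf       : WellFormed c
    complete : Complete c

Prec : History → Event → Event → Set
Prec c e e' = Before c (res e) (inv e')

IsEnq : ℕ → Event → Set
IsEnq x e = op e ≡ enq x

IsDeq : ℕ → Event → Set
IsDeq x e = op e ≡ deq (just x)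

IsDeqNull : Event → Set
IsDeqNull e = op e ≡ deq nothing

VFresh : History → Set
VFresh c = ∃[ x ] ∃[ d ] (d ∈ev c × IsDeq x d ×
  ((¬ (∃[ e ] (e ∈ev c × IsEnq x e))) ⊎
   (∃[ e ] (e ∈ev c × IsEnq x e × Prec c d e))))

VRepet : History → Set
VRepet c = ∃[ x ] ∃[ d ] ∃[ d' ] (d ∈ev c × d' ∈ev c × ¬ (d ≡ d') × IsDeq x d × IsDeq x d')

VOrd : History → Set
VOrd c = ∃[ x ] ∃[ y ] ∃[ ex ] ∃[ ey ] ∃[ dx ]
  (ex ∈ev c × IsEnq x ex × ey ∈ev c × IsEnq y ey × Prec c ey ex ×
   dx ∈ev c × IsDeq x dx ×
   ((¬ (∃[ dy ] (dy ∈ev c × IsDeq y dy))) ⊎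
    (∃[ dy ] (dy ∈ev c × IsDeq y dy × Prec c dx dy))))

VWit : History → Set
VWit c = ∃[ d ] (IsDeqNull d × ∃[ c₀ ] ∃[ cd ] ∃[ c₃ ]
  (c ≡ c₀ ++ (inv d ∷ cd ++ (res d ∷ c₃)) ×
   (∀ c₁ c₂ → cd ≡ c₁ ++ c₂ →
     let p = c₀ ++ (inv d ∷ c₁) in
     ∃[ x ] ∃[ e ] (IsEnq x e × res e ∈ p ×
       ¬ (∃[ d' ] (IsDeq x d' × inv d' ∈ p))))))

NoViolation : History → Set
NoViolation c = ¬ VFresh c × ¬ VRepet c × ¬ VOrd c × ¬ VWit c

Prefix : History → History → Set
Prefix c c' = ∃[ s ] (c' ≡ c ++ s)

deqCount : History → ℕ
deqCount [] = 0
deqCount (inv (event _ (deq _)) ∷ c) = Data.Nat.suc (deqCount c)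
deqCount (_ ∷ c) = deqCount c

-- Suppose enq(x) completes in c₀ = c 0 but x is never dequeued in c = c₀ ++ s.
-- Then no dequeue invoked in s returns NULL, since at every point of it the
-- pending enq(x) witnesses non-emptiness (VWit); every value dequeued in s was
-- enqueued in c₀, because an enqueue in s happens after enq(x) and x is never
-- dequeued (VFresh, VOrd); and these values are distinct (VRepet).  So s holds
-- at most length c₀ dequeues, whereas the dequeue count grows by at least one
-- at each step of the chain: c (1 + length c₀) must dequeue x.
module Submission where

open import Defs
open import Data.Nat using (ℕ; zero; suc; _<_; _≤_; _+_; z≤n; s≤s; _≟_)
open import Data.Nat.Properties
  using (≤-reflexive; +-identityʳ; +-suc; +-monoʳ-≤; +-cancelˡ-≤; n≮n; module ≤-Reasoning)
open import Data.Maybe using (Maybe; just; nothing)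
open import Data.Product using (_×_; ∃-syntax; _,_; map₁; map₂)
open import Data.Sum using (inj₁; inj₂)
open import Data.List using (List; []; _∷_; _++_; length; mapMaybe)
open import Data.List.Properties
  using (++-assoc; ++-identityʳ; ∷-injective; length-++-sucʳ; length-mapMaybe; mapMaybe-++)
open import Data.List.Membership.Propositional using (_∈_)
open import Data.List.Membership.Propositional.Properties
  using (∈-++⁺ˡ; ∈-++⁺ʳ; ∈-++⁻; ∈-∃++; ∈-insert)
open import Data.List.Membership.DecPropositional _≟_ using (_∈?_)
open import Data.List.Relation.Binary.Subset.Propositional using (_⊆_)
open import Data.List.Relation.Unary.Any using (here; there)
open import Data.List.Relation.Unary.All as All using ()
open import Data.List.Relation.Unary.AllPairs using ([]; _∷_)
open import Data.List.Relation.Unary.Unique.Propositional using (Unique)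
open import Data.List.Relation.Unary.Unique.Propositional.Properties using (Unique[x∷xs]⇒x∉xs)
open import Data.Empty using (⊥-elim)
open import Function using (_∘_)
open import Relation.Nullary using (¬_; yes; no; contradiction)
open import Relation.Binary.PropositionalEquality
  using (_≡_; _≢_; refl; sym; trans; cong; subst; module ≡-Reasoning)

module _ {A B : Set} (f : A → Maybe B) where

  ∈-mapMaybe⁺ : ∀ {xs x y} → x ∈ xs → f x ≡ just y → y ∈ mapMaybe f xs
  ∈-mapMaybe⁺ (here refl) fx≡y rewrite fx≡y = here refl
  ∈-mapMaybe⁺ {z ∷ _} (there x∈) fx≡y with f z
  ... | nothing = ∈-mapMaybe⁺ x∈ fx≡y
  ... | just _  = there (∈-mapMaybe⁺ x∈ fx≡y)

  ∈-mapMaybe⁻ : ∀ xs {y} → y ∈ mapMaybe f xs → ∃[ x ] (x ∈ xs × f x ≡ just y)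
  ∈-mapMaybe⁻ (x ∷ xs) y∈ with f x in fx≡
  ... | nothing = map₂ (map₁ there) (∈-mapMaybe⁻ xs y∈)
  ... | just _ with y∈
  ...   | here refl = x , here refl , fx≡
  ...   | there y∈′ = map₂ (map₁ there) (∈-mapMaybe⁻ xs y∈′)

  Unique-mapMaybe⁺ : ∀ {xs} → Unique xs →
    (∀ {a b y} → a ∈ xs → b ∈ xs → a ≢ b → f a ≡ just y → f b ≢ just y) →
    Unique (mapMaybe f xs)
  Unique-mapMaybe⁺ [] _ = []
  Unique-mapMaybe⁺ {x ∷ xs} (x∉xs ∷ u) injective
    with f x in fx≡ | Unique-mapMaybe⁺ u (λ a∈ b∈ → injective (there a∈) (there b∈))
  ... | nothing | rest = rest
  ... | just y  | rest = All.tabulate y∉ ∷ rest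
    where
    y∉ : ∀ {w} → w ∈ mapMaybe f xs → y ≢ w
    y∉ w∈ refl with b , b∈ , fb≡ ← ∈-mapMaybe⁻ xs w∈ =
      injective (here refl) (there b∈) (All.lookup x∉xs b∈) fx≡ fb≡

Unique⇒length≤ : ∀ {A : Set} {xs ys : List A} → Unique xs → xs ⊆ ys → length xs ≤ length ys
Unique⇒length≤ [] _ = z≤n
Unique⇒length≤ {xs = x ∷ xs} (x∉xs ∷ u) xs⊆ys
  with ys₁ , ys₂ , refl ← ∈-∃++ (xs⊆ys (here refl)) = begin
    suc (length xs)           ≤⟨ s≤s (Unique⇒length≤ u xs⊆ys₁ys₂) ⟩
    suc (length (ys₁ ++ ys₂)) ≡⟨ length-++-sucʳ ys₁ x ys₂ ⟨
    length (ys₁ ++ x ∷ ys₂)   ∎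
  where
  open ≤-Reasoning
  xs⊆ys₁ys₂ : xs ⊆ ys₁ ++ ys₂
  xs⊆ys₁ys₂ {z} z∈xs with ∈-++⁻ ys₁ (xs⊆ys (there z∈xs))
  ... | inj₁ z∈ys₁         = ∈-++⁺ˡ z∈ys₁
  ... | inj₂ (here refl)   = ⊥-elim (All.lookup x∉xs z∈xs refl)
  ... | inj₂ (there z∈ys₂) = ∈-++⁺ʳ ys₁ z∈ys₂

Unique-++⁻ʳ : ∀ {A : Set} (xs : List A) {ys} → Unique (xs ++ ys) → Unique ys
Unique-++⁻ʳ []       u       = u
Unique-++⁻ʳ (_ ∷ xs) (_ ∷ u) = Unique-++⁻ʳ xs u

Unique⇒prefix-determined : ∀ {A : Set} (xs xs′ : List A) {y ys ys′} → Unique (xs ++ y ∷ ys) →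
  xs ++ y ∷ ys ≡ xs′ ++ y ∷ ys′ → xs ≡ xs′
Unique⇒prefix-determined []       []        _ _    = refl
Unique⇒prefix-determined []       (_ ∷ xs′) u refl = contradiction (∈-insert xs′) (Unique[x∷xs]⇒x∉xs u)
Unique⇒prefix-determined (_ ∷ xs) []        u refl = contradiction (∈-insert xs) (Unique[x∷xs]⇒x∉xs u)
Unique⇒prefix-determined (_ ∷ xs) (_ ∷ xs′) (_ ∷ u) eq with ∷-injective eq
... | refl , eq′ = cong (_ ∷_) (Unique⇒prefix-determined xs xs′ u eq′)

Before-++ : ∀ {a b : Action} {xs ys} → a ∈ xs → b ∈ ys → Before (xs ++ ys) a b
Before-++ {a} {b} a∈ b∈
  with p , q , refl ← ∈-∃++ a∈ | r , t , refl ← ∈-∃++ b∈ = p , q ++ r , t , (begin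
    (p ++ a ∷ q) ++ r ++ b ∷ t   ≡⟨ ++-assoc p (a ∷ q) (r ++ b ∷ t) ⟩
    p ++ a ∷ q ++ r ++ b ∷ t     ≡⟨ cong (λ z → p ++ a ∷ z) (++-assoc q r (b ∷ t)) ⟨
    p ++ a ∷ (q ++ r) ++ b ∷ t   ∎)
  where open ≡-Reasoning

Prefix-refl : ∀ {c} → Prefix c c
Prefix-refl {c} = [] , sym (++-identityʳ c)

Prefix-trans : ∀ {c c′ c″} → Prefix c c′ → Prefix c′ c″ → Prefix c c″
Prefix-trans {c} (s , refl) (s′ , refl) = s ++ s′ , ++-assoc c s s′

∈-Prefix : ∀ {a c c′} → Prefix c c′ → a ∈ c → a ∈ c′
∈-Prefix (_ , refl) = ∈-++⁺ˡ

enqValue : Action → Maybe ℕ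
enqValue (inv (event _ (enq x))) = just x
enqValue _                       = nothing

deqValue : Action → Maybe ℕ
deqValue (inv (event _ (deq v))) = v
deqValue _                       = nothing

enqueued dequeued : History → List ℕ
enqueued = mapMaybe enqValue
dequeued = mapMaybe deqValue

Dequeued : ℕ → History → Set
Dequeued x c = ∃[ d ] (d ∈ev c × IsDeq x d)

deqValue≡just⇒IsDeq : ∀ {a x} → deqValue a ≡ just x → ∃[ d ] (a ≡ inv d × IsDeq x d)
deqValue≡just⇒IsDeq {inv (event u (deq (just _)))} refl = event u _ , refl , refl

∈-enqueued⁺ : ∀ {c e x} → e ∈ev c → IsEnq x e → x ∈ enqueued c
∈-enqueued⁺ {e = event _ _} e∈ refl = ∈-mapMaybe⁺ enqValue e∈ refl

∈-dequeued⁺ : ∀ {c x} → Dequeued x c → x ∈ dequeued c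
∈-dequeued⁺ (event _ _ , d∈ , refl) = ∈-mapMaybe⁺ deqValue d∈ refl

∈-dequeued⁻ : ∀ {c x} → x ∈ dequeued c → Dequeued x c
∈-dequeued⁻ {c} x∈
  with a , a∈ , deq-a ← ∈-mapMaybe⁻ deqValue c x∈
  with d , refl , deq-d ← deqValue≡just⇒IsDeq {a} deq-a = d , a∈ , deq-d

Unique-dequeued : ∀ {c} → Unique c → ¬ VRepet c → Unique (dequeued c)
Unique-dequeued {c} u ¬repet = Unique-mapMaybe⁺ deqValue u distinct
  where
  distinct : ∀ {a b y} → a ∈ c → b ∈ c → a ≢ b → deqValue a ≡ just y → deqValue b ≢ just y
  distinct {a} {b} {y} a∈ b∈ a≢b deq-a deq-b
    with d , refl , deq-d ← deqValue≡just⇒IsDeq {a} deq-a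
       | d′ , refl , deq-d′ ← deqValue≡just⇒IsDeq {b} deq-b =
    ¬repet (y , d , d′ , a∈ , b∈ , (λ d≡d′ → a≢b (cong inv d≡d′)) , deq-d , deq-d′)

deqCount-++ : ∀ c c′ → deqCount (c ++ c′) ≡ deqCount c + deqCount c′
deqCount-++ []                          _  = refl
deqCount-++ (inv (event _ (enq _)) ∷ c) c′ = deqCount-++ c c′
deqCount-++ (inv (event _ (deq _)) ∷ c) c′ = cong suc (deqCount-++ c c′)
deqCount-++ (res _ ∷ c)                 c′ = deqCount-++ c c′

deqCount≡length-dequeued : ∀ c → (∀ d → d ∈ev c → ¬ IsDeqNull d) → deqCount c ≡ length (dequeued c)
deqCount≡length-dequeued [] _ = refl
deqCount≡length-dequeued (inv (event _ (enq _)) ∷ c) non-null =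
  deqCount≡length-dequeued c (λ d d∈ → non-null d (there d∈))
deqCount≡length-dequeued (inv (event _ (deq (just _))) ∷ c) non-null =
  cong suc (deqCount≡length-dequeued c (λ d d∈ → non-null d (there d∈)))
deqCount≡length-dequeued (inv (event _ (deq nothing)) ∷ c) non-null =
  ⊥-elim (non-null _ (here refl) refl)
deqCount≡length-dequeued (res _ ∷ c) non-null =
  deqCount≡length-dequeued c (λ d d∈ → non-null d (there d∈))

strictlyIncreasing⇒f0+i≤fi : (f : ℕ → ℕ) → (∀ i → f i < f (suc i)) → ∀ i → f 0 + i ≤ f i
strictlyIncreasing⇒f0+i≤fi f increasing zero    = ≤-reflexive (+-identityʳ (f 0))
strictlyIncreasing⇒f0+i≤fi f increasing (suc i) = begin
  f 0 + suc i   ≡⟨ +-suc (f 0) i ⟩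
  suc (f 0 + i) ≤⟨ s≤s (strictlyIncreasing⇒f0+i≤fi f increasing i) ⟩
  suc (f i)     ≤⟨ increasing i ⟩
  f (suc i)     ∎
  where open ≤-Reasoning

module NeverDequeued {c₀ s : History} (c-complete : CompleteHistory (c₀ ++ s))
  {x : ℕ} {e : Event} (e-enq : IsEnq x e) (e-inv : inv e ∈ c₀) (e-res : res e ∈ c₀)
  (x-never : ¬ Dequeued x (c₀ ++ s)) where

  open CompleteHistory c-complete
  open WellFormed wf

  suffix-no-null-dequeue : ¬ VWit (c₀ ++ s) → ∀ d → d ∈ev s → ¬ IsDeqNull d
  suffix-no-null-dequeue ¬wit d d∈s null
    with s₁ , s₂ , refl ← ∈-∃++ d∈s
    with a , b , c′ , c≡ ← res-after-inv d (complete d (∈-++⁺ʳ c₀ d∈s)) =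
      ¬wit (d , null , a , b , c′ , c≡ , witness)
    where
    a≡c₀s₁ : a ≡ c₀ ++ s₁
    a≡c₀s₁ = Unique⇒prefix-determined a (c₀ ++ s₁) (subst Unique c≡ unique-actions)
               (trans (sym c≡) (sym (++-assoc c₀ s₁ (inv d ∷ s₂))))
    witness : ∀ c₁ c₂ → b ≡ c₁ ++ c₂ →
      ∃[ y ] ∃[ e′ ] (IsEnq y e′ × res e′ ∈ a ++ inv d ∷ c₁ ×
                      ¬ (∃[ d′ ] (IsDeq y d′ × inv d′ ∈ a ++ inv d ∷ c₁)))
    witness c₁ c₂ refl =
      x , e , e-enq , ∈-++⁺ˡ (subst (res e ∈_) (sym a≡c₀s₁) (∈-++⁺ˡ e-res)) ,
      λ (d′ , deq-x , d′∈) → x-never (d′ , ∈-Prefix observed d′∈ , deq-x)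
      where
      observed : Prefix (a ++ inv d ∷ c₁) (c₀ ++ s)
      observed = c₂ ++ res d ∷ c′ , (begin
        c₀ ++ s                                ≡⟨ c≡ ⟩
        a ++ inv d ∷ (c₁ ++ c₂) ++ res d ∷ c′  ≡⟨ cong (λ t → a ++ inv d ∷ t) (++-assoc c₁ c₂ _) ⟩
        a ++ (inv d ∷ c₁) ++ c₂ ++ res d ∷ c′  ≡⟨ ++-assoc a (inv d ∷ c₁) _ ⟨
        (a ++ inv d ∷ c₁) ++ c₂ ++ res d ∷ c′  ∎)
        where open ≡-Reasoning

  suffix-dequeued⊆enqueued : ¬ VFresh (c₀ ++ s) → ¬ VOrd (c₀ ++ s) → dequeued s ⊆ enqueued c₀
  suffix-dequeued⊆enqueued ¬fresh ¬ord {y} y∈ with y ∈? enqueued c₀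
  ... | yes y∈enqueued = y∈enqueued
  ... | no  y∉enqueued with d , d∈s , deq-y ← ∈-dequeued⁻ {s} y∈ =
    ⊥-elim (¬fresh (y , d , ∈-++⁺ʳ c₀ d∈s , deq-y , inj₁ never-enqueued))
    where
    never-enqueued : ¬ (∃[ e′ ] (e′ ∈ev (c₀ ++ s) × IsEnq y e′))
    never-enqueued (e′ , e′∈ , e′-enq) with ∈-++⁻ c₀ e′∈
    ... | inj₁ e′∈c₀ = y∉enqueued (∈-enqueued⁺ e′∈c₀ e′-enq)
    ... | inj₂ e′∈s  = ¬ord (y , x , e′ , e , d , e′∈ , e′-enq , ∈-++⁺ˡ e-inv , e-enq ,
                             Before-++ e-res e′∈s , ∈-++⁺ʳ c₀ d∈s , deq-y , inj₁ x-never)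

  suffix-deqCount≤length : NoViolation (c₀ ++ s) → deqCount s ≤ length c₀
  suffix-deqCount≤length (¬fresh , ¬repet , ¬ord , ¬wit) = begin
    deqCount s                ≡⟨ deqCount≡length-dequeued s (suffix-no-null-dequeue ¬wit) ⟩
    length (dequeued s)       ≤⟨ Unique⇒length≤ distinct (suffix-dequeued⊆enqueued ¬fresh ¬ord) ⟩
    length (enqueued c₀)      ≤⟨ length-mapMaybe enqValue c₀ ⟩
    length c₀                 ∎
    where
    open ≤-Reasoning
    distinct : Unique (dequeued s)
    distinct = Unique-++⁻ʳ (dequeued c₀)
      (subst Unique (mapMaybe-++ deqValue c₀ s) (Unique-dequeued unique-actions ¬repet))

never-dequeued⇒deqCount≤ : ∀ {c₀ c x e} → CompleteHistory c → NoViolation c → Prefix c₀ c →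
  IsEnq x e → inv e ∈ c₀ → res e ∈ c₀ → ¬ Dequeued x c →
  deqCount c ≤ deqCount c₀ + length c₀
never-dequeued⇒deqCount≤ {c₀} complete ok (s , refl) e-enq e-inv e-res never = begin
  deqCount (c₀ ++ s)        ≡⟨ deqCount-++ c₀ s ⟩
  deqCount c₀ + deqCount s  ≤⟨ +-monoʳ-≤ (deqCount c₀) (suffix-deqCount≤length ok) ⟩
  deqCount c₀ + length c₀   ∎
  where
  open ≤-Reasoning
  open NeverDequeued complete e-enq e-inv e-res never

proposition4p9 : (c : ℕ → History) →
    (∀ i → CompleteHistory (c i)) →
    (∀ i → NoViolation (c i)) →
    (∀ i → Prefix (c i) (c (suc i))) →
    (∀ i → deqCount (c i) < deqCount (c (suc i))) →
    (x : ℕ) → (∃[ e ] (e ∈ev c 0 × IsEnq x e)) →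
    ∃[ j ] ∃[ d ] (d ∈ev c j × IsDeq x d)
proposition4p9 c complete ok extends grows x (e , e-inv , e-enq)
  with x ∈? dequeued (c (suc (length (c 0))))
... | yes x∈ = _ , ∈-dequeued⁻ x∈
... | no  x∉ = ⊥-elim (n≮n L (+-cancelˡ-≤ (deqCount (c 0)) j L (begin
  deqCount (c 0) + j  ≤⟨ strictlyIncreasing⇒f0+i≤fi (λ i → deqCount (c i)) grows j ⟩
  deqCount (c j)      ≤⟨ never-dequeued⇒deqCount≤ (complete j) (ok j) (from-start j) e-enq e-inv
                           (CompleteHistory.complete (complete 0) e e-inv) (x∉ ∘ ∈-dequeued⁺) ⟩
  deqCount (c 0) + L  ∎)))
  where
  open ≤-Reasoning
  L j : ℕ
  L = length (c 0)
  j = suc L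
  from-start : ∀ i → Prefix (c 0) (c i)
  from-start zero    = Prefix-refl
  from-start (suc i) = Prefix-trans (from-start i) (extends i)
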